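{- For all positive integers $r,\kappa'$, \[ \sum_{0\le i\le\lfloor r/2\rfloor}\ \prod_{0\le l\le i-1}\frac{(r-2l)^2(r-2l-1)^2}{(2i-2l)(2i+2\kappa'-2l)(r-2i+2l+1)(r-2i+2l+2)}=2^{ -r}\frac{\binom{2\kappa'+2r}{r}}{\binom{\kappa'+r}{r}}, \] where the empty product (for $i=0$) equals $1$. -}

module Defs where

open import Data.Nat as ℕ using (ℕ; zero; suc)
open import Data.Rational using (ℚ; _/_; 0ℚ; 1ℚ; _+_; _*_; _-_; _÷_; _≟_; ≢-nonZero)
open import Relation.Nullary using (yes; no)
open import Data.Integer using (+_)

ℕ→ℚ : ℕ → ℚ
ℕ→ℚ n = (+ n) / 1

-- total division on ℚ: p / q for q ≠ 0, and 0 when q = 0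
-- (only ever applied to nonzero denominators in the statement)
_÷₀_ : ℚ → ℚ → ℚ
p ÷₀ q with q ≟ 0ℚ
... | yes _ = 0ℚ
... | no q≢0 = _÷_ p q {{≢-nonZero q≢0}}

sumRange : ℕ → (ℕ → ℚ) → ℚ
sumRange zero    f = 0ℚ
sumRange (suc n) f = sumRange n f + f n

prodRange : ℕ → (ℕ → ℚ) → ℚ
prodRange zero    f = 1ℚ
prodRange (suc n) f = prodRange n f * f n

_^ℚ_ : ℚ → ℕ → ℚ
q ^ℚ zero  = 1ℚ
q ^ℚ suc n = q * (q ^ℚ n)

-- Write F(r,i) = C(r,2i)·(1/2)ᵢ/(κ′+1)ᵢ. For 2i ≤ r the i-th product of the statement is F(r,i):
-- its numerator is (r!/(r−2i)!)², its denominator is 4ⁱ·i!·(κ′+1)ᵢ·r!/(r−2i)!, and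
-- (2i)!/(4ⁱ·i!) = (1/2)ᵢ. Since F(r,i) = 0 for 2i > r, the left side is S(r) = Σᵢ F(r,i).
-- Zeilberger's algorithm gives (2κ′+r+1)·F(r+1,i) − (2κ′+2r+1)·F(r,i) = G(i+1) − G(i) with
-- G(i+1) = −C(r,2i+1)·(2i+1)·(1/2)ᵢ/(κ′+1)ᵢ, so S satisfies (2κ′+r+1)·S(r+1) = (2κ′+2r+1)·S(r).
-- The right side satisfies the same first-order recurrence by the absorption identities for
-- binomial coefficients, and both sides equal 1 at r = 0.

module Submission where

open import Defs
open import Data.Nat as ℕ using (ℕ; zero; suc; _/_; _≥_)
open import Data.Nat.Combinatorics using (_C_)
open import Data.Rational using (ℚ; 1ℚ; _+_; _*_; _-_)
open import Relation.Binary.PropositionalEquality using (_≡_)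

import Data.Integer as ℤ
import Data.Integer.Properties as ℤ
import Data.Nat.Properties as ℕ
import Data.Nat.Tactic.RingSolver as ℕ-Solver
open import Data.Nat.Combinatorics using (nCk+nC[k+1]≡[n+1]C[k+1]; nC1≡n; k>n⇒nCk≡0)
open import Data.Nat.DivMod using (m/n*n≤m; m*n/n≡m; /-monoˡ-≤; m/n≤m)
import Data.Nat.Coprimality as Coprimality
open import Data.Rational as ℚ using (mkℚ; 0ℚ; 1/_; -_; ≢-nonZero)
open import Data.Rational.Properties as ℚ using (+-*-commutativeRing)
open import Data.Empty using (⊥-elim)
open import Data.List using (_∷_; [])
open import Data.Maybe using (Maybe; just; nothing)
open import Relation.Nullary using (yes; no)
open import Relation.Binary.PropositionalEquality
  using (_≢_; refl; sym; trans; cong; cong₂; subst; module ≡-Reasoning)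
open import Level using (0ℓ)
open import Tactic.RingSolver using (solve; solve-∀)
import Tactic.RingSolver.Core.AlmostCommutativeRing as ACR
open ≡-Reasoning

ℚ-ring : ACR.AlmostCommutativeRing 0ℓ 0ℓ
ℚ-ring = ACR.fromCommutativeRing +-*-commutativeRing 0≟_
  where
  0≟_ : ∀ p → Maybe (0ℚ ≡ p)
  0≟ p with p ℚ.≟ 0ℚ
  ... | yes p≡0 = just (sym p≡0)
  ... | no _    = nothing

*-cancelʳ-≡ : ∀ p q r → r ≢ 0ℚ → p * r ≡ q * r → p ≡ q
*-cancelʳ-≡ p q r r≢0 pr≡qr = begin
  p                ≡⟨ p*r*r⁻¹≡p p ⟨
  p * r * 1/ r     ≡⟨ cong (_* 1/ r) pr≡qr ⟩
  q * r * 1/ r     ≡⟨ p*r*r⁻¹≡p q ⟩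
  q                ∎
  where
  instance _ = ≢-nonZero r≢0
  p*r*r⁻¹≡p : ∀ p → p * r * 1/ r ≡ p
  p*r*r⁻¹≡p p = trans (ℚ.*-assoc p r (1/ r))
    (trans (cong (p *_) (ℚ.*-inverseʳ r)) (ℚ.*-identityʳ p))

*-≢0 : ∀ {p q} → p ≢ 0ℚ → q ≢ 0ℚ → p * q ≢ 0ℚ
*-≢0 {p} {q} p≢0 q≢0 pq≡0 =
  q≢0 (*-cancelʳ-≡ q 0ℚ p p≢0 (trans (ℚ.*-comm q p) (trans pq≡0 (sym (ℚ.*-zeroˡ p)))))

p÷₀q*q≡p : ∀ p q → q ≢ 0ℚ → (p ÷₀ q) * q ≡ p
p÷₀q*q≡p p q q≢0 with q ℚ.≟ 0ℚ
... | yes q≡0 = ⊥-elim (q≢0 q≡0)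
... | no  _   = trans (ℚ.*-assoc p (1/ q) q)
  (trans (cong (p *_) (ℚ.*-inverseˡ q)) (ℚ.*-identityʳ p))
  where instance _ = ≢-nonZero q≢0

-- ℕ→ℚ n goes through normalisation; on its normal form mkℚ n 1 the operations _+_ and _*_ compute.
ℕ→ℚ-mkℚ : ∀ n → ℕ→ℚ n ≡ mkℚ (ℤ.+ n) 0 (Coprimality.sym (Coprimality.1-coprimeTo n))
ℕ→ℚ-mkℚ n = ℚ.↥p/↧p≡p _

ℕ→ℚ-homo-+ : ∀ m n → ℕ→ℚ (m ℕ.+ n) ≡ ℕ→ℚ m + ℕ→ℚ n
ℕ→ℚ-homo-+ m n = begin
  ℕ→ℚ (m ℕ.+ n)
    ≡⟨ cong₂ (λ a b → (a ℤ.+ b) ℚ./ 1) (ℤ.*-identityʳ (ℤ.+ m)) (ℤ.*-identityʳ (ℤ.+ n)) ⟨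
  ((ℤ.+ m) ℤ.* (ℤ.+ 1) ℤ.+ (ℤ.+ n) ℤ.* (ℤ.+ 1)) ℚ./ 1
    ≡⟨ cong₂ _+_ (ℕ→ℚ-mkℚ m) (ℕ→ℚ-mkℚ n) ⟨
  ℕ→ℚ m + ℕ→ℚ n ∎

ℕ→ℚ-homo-* : ∀ m n → ℕ→ℚ (m ℕ.* n) ≡ ℕ→ℚ m * ℕ→ℚ n
ℕ→ℚ-homo-* m n = sym (trans (cong₂ _*_ (ℕ→ℚ-mkℚ m) (ℕ→ℚ-mkℚ n))
  (cong (ℚ._/ 1) (sym (ℤ.pos-* m n))))

ℕ→ℚ-suc : ∀ n → ℕ→ℚ (suc n) ≡ ℕ→ℚ n + 1ℚ
ℕ→ℚ-suc n = trans (cong ℕ→ℚ (ℕ.+-comm 1 n)) (ℕ→ℚ-homo-+ n 1)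

ℕ→ℚ-≢0 : ∀ n → 0 ℕ.< n → ℕ→ℚ n ≢ 0ℚ
ℕ→ℚ-≢0 (suc n) _ eq with trans (sym (ℕ→ℚ-mkℚ (suc n))) eq
... | ()

sumRange-cong : ∀ n {f g : ℕ → ℚ} → (∀ i → i ℕ.< n → f i ≡ g i) → sumRange n f ≡ sumRange n g
sumRange-cong zero    f≗g = refl
sumRange-cong (suc n) f≗g =
  cong₂ _+_ (sumRange-cong n (λ i i<n → f≗g i (ℕ.m<n⇒m<1+n i<n))) (f≗g n (ℕ.n<1+n n))

sumRange-extend : ∀ {m n} (f : ℕ → ℚ) → m ℕ.≤ n → (∀ i → m ℕ.≤ i → f i ≡ 0ℚ) →
                  sumRange n f ≡ sumRange m f
sumRange-extend {m} f m≤n tail≡0 = go (ℕ.≤⇒≤′ m≤n)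
  where
  go : ∀ {n} → m ℕ.≤′ n → sumRange n f ≡ sumRange m f
  go ℕ.≤′-refl                = refl
  go {suc n} (ℕ.≤′-step m≤′n) =
    trans (cong₂ _+_ (go m≤′n) (tail≡0 n (ℕ.≤′⇒≤ m≤′n))) (ℚ.+-identityʳ _)

sumRange-telescope : ∀ (f g : ℕ → ℚ) → (∀ i → f i ≡ g (suc i) - g i) →
                     ∀ n → sumRange n f ≡ g n - g 0
sumRange-telescope f g f≡Δg zero    = sym (ℚ.+-inverseʳ (g 0))
sumRange-telescope f g f≡Δg (suc n) = begin
  sumRange n f + f n                  ≡⟨ cong₂ _+_ (sumRange-telescope f g f≡Δg n) (f≡Δg n) ⟩
  (g n - g 0) + (g (suc n) - g n)     ≡⟨ cancel (g n) (g 0) (g (suc n)) ⟩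
  g (suc n) - g 0                     ∎
  where
  cancel : ∀ a b c → (a - b) + (c - a) ≡ c - b
  cancel = solve-∀ ℚ-ring

sumRange-linear : ∀ n α β (u v : ℕ → ℚ) →
  sumRange n (λ i → α * u i - β * v i) ≡ α * sumRange n u - β * sumRange n v
sumRange-linear zero    α β u v = solve (α ∷ β ∷ []) ℚ-ring
sumRange-linear (suc n) α β u v = begin
  sumRange n (λ i → α * u i - β * v i) + (α * ui - β * vi)
                                         ≡⟨ cong (_+ (α * ui - β * vi)) (sumRange-linear n α β u v) ⟩
  (α * su - β * sv) + (α * ui - β * vi)  ≡⟨ regroup α β su sv ui vi ⟩
  α * (su + ui) - β * (sv + vi)          ∎
  where
  su = sumRange n u; sv = sumRange n v; ui = u n; vi = v n
  regroup : ∀ α β a b c d → (α * a - β * b) + (α * c - β * d) ≡ α * (a + c) - β * (b + d)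
  regroup = solve-∀ ℚ-ring

prodRange-cong : ∀ n {f g : ℕ → ℚ} → (∀ i → i ℕ.< n → f i ≡ g i) → prodRange n f ≡ prodRange n g
prodRange-cong zero    f≗g = refl
prodRange-cong (suc n) f≗g =
  cong₂ _*_ (prodRange-cong n (λ i i<n → f≗g i (ℕ.m<n⇒m<1+n i<n))) (f≗g n (ℕ.n<1+n n))

prodRange-head : ∀ n (f : ℕ → ℚ) → prodRange (suc n) f ≡ f 0 * prodRange n (λ i → f (suc i))
prodRange-head zero    f = trans (ℚ.*-identityˡ (f 0)) (sym (ℚ.*-identityʳ (f 0)))
prodRange-head (suc n) f = trans (cong (_* f (suc n)) (prodRange-head n f)) (ℚ.*-assoc (f 0) _ _)

prodRange-≢0 : ∀ n {f : ℕ → ℚ} → (∀ i → i ℕ.< n → f i ≢ 0ℚ) → prodRange n f ≢ 0ℚ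
prodRange-≢0 zero    f≢0 ()
prodRange-≢0 (suc n) f≢0 =
  *-≢0 (prodRange-≢0 n (λ i i<n → f≢0 i (ℕ.m<n⇒m<1+n i<n))) (f≢0 n (ℕ.n<1+n n))

prodRange-÷₀ : ∀ n (f g : ℕ → ℚ) → (∀ i → i ℕ.< n → g i ≢ 0ℚ) →
               prodRange n (λ i → f i ÷₀ g i) * prodRange n g ≡ prodRange n f
prodRange-÷₀ zero    f g g≢0 = refl
prodRange-÷₀ (suc n) f g g≢0 = begin
  (P * (fn ÷₀ gn)) * (G * gn)   ≡⟨ interchange P (fn ÷₀ gn) G gn ⟩
  (P * G) * ((fn ÷₀ gn) * gn)   ≡⟨ cong₂ _*_ (prodRange-÷₀ n f g (λ i i<n → g≢0 i (ℕ.m<n⇒m<1+n i<n)))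
                                             (p÷₀q*q≡p fn gn (g≢0 n (ℕ.n<1+n n))) ⟩
  prodRange n f * fn            ∎
  where
  P = prodRange n (λ i → f i ÷₀ g i); G = prodRange n g; fn = f n; gn = g n
  interchange : ∀ a b c d → (a * b) * (c * d) ≡ (a * c) * (b * d)
  interchange = solve-∀ ℚ-ring

m≤o/n⇒m*n≤o : ∀ {m} o n .{{_ : ℕ.NonZero n}} → m ℕ.≤ o / n → m ℕ.* n ℕ.≤ o
m≤o/n⇒m*n≤o o n m≤o/n = ℕ.≤-trans (ℕ.*-monoˡ-≤ n m≤o/n) (m/n*n≤m o n)

m*n≤o⇒m≤o/n : ∀ m {o} n .{{_ : ℕ.NonZero n}} → m ℕ.* n ℕ.≤ o → m ℕ.≤ o / n
m*n≤o⇒m≤o/n m n m*n≤o = subst (ℕ._≤ _ / n) (m*n/n≡m m n) (/-monoˡ-≤ n m*n≤o)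

[k+1]*nC[k+1]+k*nCk≡n*nCk : ∀ n k → suc k ℕ.* (n C suc k) ℕ.+ k ℕ.* (n C k) ≡ n ℕ.* (n C k)
[k+1]*nC[k+1]+k*nCk≡n*nCk zero    zero    = refl
[k+1]*nC[k+1]+k*nCk≡n*nCk zero    (suc k) = cong₂ ℕ._+_ (ℕ.*-zeroʳ (2 ℕ.+ k)) (ℕ.*-zeroʳ (suc k))
[k+1]*nC[k+1]+k*nCk≡n*nCk (suc n) zero    =
  trans (ℕ.+-identityʳ _) (trans (ℕ.*-identityˡ _) (trans (nC1≡n (suc n)) (sym (ℕ.*-identityʳ (suc n)))))
[k+1]*nC[k+1]+k*nCk≡n*nCk (suc n) (suc k) = begin
  (2 ℕ.+ k) ℕ.* (suc n C (2 ℕ.+ k)) ℕ.+ suc k ℕ.* (suc n C suc k)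
    ≡⟨ cong₂ (λ u v → (2 ℕ.+ k) ℕ.* u ℕ.+ suc k ℕ.* v)
             (nCk+nC[k+1]≡[n+1]C[k+1] n (suc k)) (nCk+nC[k+1]≡[n+1]C[k+1] n k) ⟨
  (2 ℕ.+ k) ℕ.* (b ℕ.+ c) ℕ.+ suc k ℕ.* (a ℕ.+ b)
    ≡⟨ combine n k a b c ([k+1]*nC[k+1]+k*nCk≡n*nCk n (suc k)) ([k+1]*nC[k+1]+k*nCk≡n*nCk n k) ⟩
  suc n ℕ.* (a ℕ.+ b)
    ≡⟨ cong (suc n ℕ.*_) (nCk+nC[k+1]≡[n+1]C[k+1] n k) ⟩
  suc n ℕ.* (suc n C suc k) ∎
  where
  a = n C k; b = n C suc k; c = n C suc (suc k)
  combine : ∀ n k a b c → (2 ℕ.+ k) ℕ.* c ℕ.+ suc k ℕ.* b ≡ n ℕ.* b → suc k ℕ.* b ℕ.+ k ℕ.* a ≡ n ℕ.* a →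
            (2 ℕ.+ k) ℕ.* (b ℕ.+ c) ℕ.+ suc k ℕ.* (a ℕ.+ b) ≡ suc n ℕ.* (a ℕ.+ b)
  combine n k a b c c-step b-step = begin
    (2 ℕ.+ k) ℕ.* (b ℕ.+ c) ℕ.+ suc k ℕ.* (a ℕ.+ b)
      ≡⟨ ℕ-Solver.solve (n ∷ k ∷ a ∷ b ∷ c ∷ []) ⟩
    b ℕ.+ ((2 ℕ.+ k) ℕ.* c ℕ.+ suc k ℕ.* b) ℕ.+ (suc k ℕ.* b ℕ.+ k ℕ.* a) ℕ.+ a
      ≡⟨ cong₂ (λ u v → b ℕ.+ u ℕ.+ v ℕ.+ a) c-step b-step ⟩
    b ℕ.+ n ℕ.* b ℕ.+ n ℕ.* a ℕ.+ a
      ≡⟨ ℕ-Solver.solve (n ∷ a ∷ b ∷ []) ⟩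
    suc n ℕ.* (a ℕ.+ b) ∎

[k+1]*[n+1]C[k+1]≡[n+1]*nCk : ∀ n k → suc k ℕ.* (suc n C suc k) ≡ suc n ℕ.* (n C k)
[k+1]*[n+1]C[k+1]≡[n+1]*nCk n k = begin
  suc k ℕ.* (suc n C suc k)   ≡⟨ cong (suc k ℕ.*_) (nCk+nC[k+1]≡[n+1]C[k+1] n k) ⟨
  suc k ℕ.* (a ℕ.+ b)         ≡⟨ split k a b ⟩
  a ℕ.+ (suc k ℕ.* b ℕ.+ k ℕ.* a)   ≡⟨ cong (a ℕ.+_) ([k+1]*nC[k+1]+k*nCk≡n*nCk n k) ⟩
  suc n ℕ.* a                 ∎
  where
  a = n C k; b = n C suc k
  split : ∀ k a b → suc k ℕ.* (a ℕ.+ b) ≡ a ℕ.+ (suc k ℕ.* b ℕ.+ k ℕ.* a)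
  split = ℕ-Solver.solve-∀

[m+1]*[m+k+1]Ck≡[m+k+1]*[m+k]Ck : ∀ m k →
  suc m ℕ.* (suc (m ℕ.+ k) C k) ≡ suc (m ℕ.+ k) ℕ.* ((m ℕ.+ k) C k)
[m+1]*[m+k+1]Ck≡[m+k+1]*[m+k]Ck m k = sym (ℕ.+-cancelʳ-≡ (k ℕ.* X) _ _ (begin
  suc n ℕ.* (n C k) ℕ.+ k ℕ.* X       ≡⟨ cong (ℕ._+ k ℕ.* X) ([k+1]*[n+1]C[k+1]≡[n+1]*nCk n k) ⟨
  suc k ℕ.* (suc n C suc k) ℕ.+ k ℕ.* X ≡⟨ [k+1]*nC[k+1]+k*nCk≡n*nCk (suc n) k ⟩
  suc n ℕ.* X                         ≡⟨ ℕ.*-distribʳ-+ X (suc m) k ⟩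
  suc m ℕ.* X ℕ.+ k ℕ.* X             ∎))
  where
  n = m ℕ.+ k; X = suc n C k

[n+k]Ck>0 : ∀ n k → 0 ℕ.< (n ℕ.+ k) C k
[n+k]Ck>0 n zero    = ℕ.z<s
[n+k]Ck>0 n (suc k) = subst (λ m → 0 ℕ.< m C suc k) (sym (ℕ.+-suc n k))
  (subst (0 ℕ.<_) (nCk+nC[k+1]≡[n+1]C[k+1] (n ℕ.+ k) k) (ℕ.<-≤-trans ([n+k]Ck>0 n k) (ℕ.m≤m+n _ _)))

binomialQuotient-rec : ∀ k r →
  suc (2 ℕ.* k ℕ.+ r) ℕ.* ((2 ℕ.* k ℕ.+ 2 ℕ.* suc r) C suc r) ℕ.* ((k ℕ.+ r) C r)
    ≡ 2 ℕ.* suc (2 ℕ.* k ℕ.+ 2 ℕ.* r) ℕ.* ((2 ℕ.* k ℕ.+ 2 ℕ.* r) C r) ℕ.* ((k ℕ.+ suc r) C suc r)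
-- After multiplying by r + 1 both sides are products of absorption identities.
binomialQuotient-rec k r = ℕ.*-cancelʳ-≡ _ _ (suc r) (combine k r _ _ _ _ _ x′-step x₁-step y′-step)
  where
  N = 2 ℕ.* k ℕ.+ 2 ℕ.* r
  2k+2[r+1]≡2+2k+2r : ∀ k r → 2 ℕ.* k ℕ.+ 2 ℕ.* suc r ≡ suc (suc (2 ℕ.* k ℕ.+ 2 ℕ.* r))
  2k+2[r+1]≡2+2k+2r = ℕ-Solver.solve-∀
  [2k+r]+r≡2k+2r : ∀ k r → 2 ℕ.* k ℕ.+ r ℕ.+ r ≡ 2 ℕ.* k ℕ.+ 2 ℕ.* r
  [2k+r]+r≡2k+2r = ℕ-Solver.solve-∀
  x′-step : suc r ℕ.* ((2 ℕ.* k ℕ.+ 2 ℕ.* suc r) C suc r) ≡ suc (suc N) ℕ.* (suc N C r)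
  x′-step = trans (cong (λ n → suc r ℕ.* (n C suc r)) (2k+2[r+1]≡2+2k+2r k r))
                  ([k+1]*[n+1]C[k+1]≡[n+1]*nCk (suc N) r)
  x₁-step : suc (2 ℕ.* k ℕ.+ r) ℕ.* (suc N C r) ≡ suc N ℕ.* (N C r)
  x₁-step = subst (λ n → suc (2 ℕ.* k ℕ.+ r) ℕ.* (suc n C r) ≡ suc n ℕ.* (n C r))
                 ([2k+r]+r≡2k+2r k r) ([m+1]*[m+k+1]Ck≡[m+k+1]*[m+k]Ck (2 ℕ.* k ℕ.+ r) r)
  y′-step : suc r ℕ.* ((k ℕ.+ suc r) C suc r) ≡ suc (k ℕ.+ r) ℕ.* ((k ℕ.+ r) C r)
  y′-step = trans (cong (λ n → suc r ℕ.* (n C suc r)) (ℕ.+-suc k r))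
                  ([k+1]*[n+1]C[k+1]≡[n+1]*nCk (k ℕ.+ r) r)
  combine : ∀ k r x x₁ x′ y y′ →
    suc r ℕ.* x′ ≡ suc (suc (2 ℕ.* k ℕ.+ 2 ℕ.* r)) ℕ.* x₁ →
    suc (2 ℕ.* k ℕ.+ r) ℕ.* x₁ ≡ suc (2 ℕ.* k ℕ.+ 2 ℕ.* r) ℕ.* x →
    suc r ℕ.* y′ ≡ suc (k ℕ.+ r) ℕ.* y →
    suc (2 ℕ.* k ℕ.+ r) ℕ.* x′ ℕ.* y ℕ.* suc r
      ≡ 2 ℕ.* suc (2 ℕ.* k ℕ.+ 2 ℕ.* r) ℕ.* x ℕ.* y′ ℕ.* suc r
  combine k r x x₁ x′ y y′ x′-step x₁-step y′-step = begin
    suc (2 ℕ.* k ℕ.+ r) ℕ.* x′ ℕ.* y ℕ.* suc r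
      ≡⟨ ℕ-Solver.solve (k ∷ r ∷ x′ ∷ y ∷ []) ⟩
    suc (2 ℕ.* k ℕ.+ r) ℕ.* y ℕ.* (suc r ℕ.* x′)
      ≡⟨ cong (suc (2 ℕ.* k ℕ.+ r) ℕ.* y ℕ.*_) x′-step ⟩
    suc (2 ℕ.* k ℕ.+ r) ℕ.* y ℕ.* (suc (suc (2 ℕ.* k ℕ.+ 2 ℕ.* r)) ℕ.* x₁)
      ≡⟨ ℕ-Solver.solve (k ∷ r ∷ x₁ ∷ y ∷ []) ⟩
    suc (suc (2 ℕ.* k ℕ.+ 2 ℕ.* r)) ℕ.* y ℕ.* (suc (2 ℕ.* k ℕ.+ r) ℕ.* x₁)
      ≡⟨ cong (suc (suc (2 ℕ.* k ℕ.+ 2 ℕ.* r)) ℕ.* y ℕ.*_) x₁-step ⟩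
    suc (suc (2 ℕ.* k ℕ.+ 2 ℕ.* r)) ℕ.* y ℕ.* (suc (2 ℕ.* k ℕ.+ 2 ℕ.* r) ℕ.* x)
      ≡⟨ ℕ-Solver.solve (k ∷ r ∷ x ∷ y ∷ []) ⟩
    2 ℕ.* suc (2 ℕ.* k ℕ.+ 2 ℕ.* r) ℕ.* x ℕ.* (suc (k ℕ.+ r) ℕ.* y)
      ≡⟨ cong (2 ℕ.* suc (2 ℕ.* k ℕ.+ 2 ℕ.* r) ℕ.* x ℕ.*_) y′-step ⟨
    2 ℕ.* suc (2 ℕ.* k ℕ.+ 2 ℕ.* r) ℕ.* x ℕ.* (suc r ℕ.* y′)
      ≡⟨ ℕ-Solver.solve (k ∷ r ∷ x ∷ y′ ∷ []) ⟩
    2 ℕ.* suc (2 ℕ.* k ℕ.+ 2 ℕ.* r) ℕ.* x ℕ.* y′ ℕ.* suc r ∎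

[k+1]*nC[k+1]≡[n-k]*nCk : ∀ n k {K} → ℕ→ℚ k ≡ K →
  (K + 1ℚ) * ℕ→ℚ (n C suc k) ≡ (ℕ→ℚ n - K) * ℕ→ℚ (n C k)
[k+1]*nC[k+1]≡[n-k]*nCk n k refl = begin
  (ℕ→ℚ k + 1ℚ) * X                              ≡⟨ add-sub (ℕ→ℚ k + 1ℚ) X (ℕ→ℚ k) Y ⟩
  ((ℕ→ℚ k + 1ℚ) * X + ℕ→ℚ k * Y) - ℕ→ℚ k * Y   ≡⟨ cong (_- ℕ→ℚ k * Y) cast ⟩
  ℕ→ℚ n * Y - ℕ→ℚ k * Y                         ≡⟨ factor (ℕ→ℚ n) (ℕ→ℚ k) Y ⟩
  (ℕ→ℚ n - ℕ→ℚ k) * Y                           ∎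
  where
  X = ℕ→ℚ (n C suc k); Y = ℕ→ℚ (n C k)
  cast : (ℕ→ℚ k + 1ℚ) * X + ℕ→ℚ k * Y ≡ ℕ→ℚ n * Y
  cast = begin
    (ℕ→ℚ k + 1ℚ) * X + ℕ→ℚ k * Y
      ≡⟨ cong (λ c → c * X + ℕ→ℚ k * Y) (ℕ→ℚ-suc k) ⟨
    ℕ→ℚ (suc k) * X + ℕ→ℚ k * Y
      ≡⟨ cong₂ _+_ (ℕ→ℚ-homo-* (suc k) (n C suc k)) (ℕ→ℚ-homo-* k (n C k)) ⟨
    ℕ→ℚ (suc k ℕ.* (n C suc k)) + ℕ→ℚ (k ℕ.* (n C k))
      ≡⟨ ℕ→ℚ-homo-+ (suc k ℕ.* (n C suc k)) (k ℕ.* (n C k)) ⟨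
    ℕ→ℚ (suc k ℕ.* (n C suc k) ℕ.+ k ℕ.* (n C k))
      ≡⟨ cong ℕ→ℚ ([k+1]*nC[k+1]+k*nCk≡n*nCk n k) ⟩
    ℕ→ℚ (n ℕ.* (n C k))
      ≡⟨ ℕ→ℚ-homo-* n (n C k) ⟩
    ℕ→ℚ n * Y ∎
  add-sub : ∀ a x b y → a * x ≡ (a * x + b * y) - b * y
  add-sub = solve-∀ ℚ-ring
  factor : ∀ a b y → a * y - b * y ≡ (a - b) * y
  factor = solve-∀ ℚ-ring

-- pochhammerRatio k i = (1/2)ᵢ / (k+1)ᵢ = ∏_{l<i} (2l+1) / (2k+2l+2)
pochhammerRatio : ℕ → ℕ → ℚ
pochhammerRatio k zero    = 1ℚ
pochhammerRatio k (suc i) = ((ℕ→ℚ 2 * ℕ→ℚ i + 1ℚ) * pochhammerRatio k i) ÷₀ ℕ→ℚ (2 ℕ.* suc (k ℕ.+ i))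

pochhammerRatio-suc : ∀ k i →
  ℕ→ℚ 2 * (ℕ→ℚ k + ℕ→ℚ i + 1ℚ) * pochhammerRatio k (suc i) ≡ (ℕ→ℚ 2 * ℕ→ℚ i + 1ℚ) * pochhammerRatio k i
pochhammerRatio-suc k i = begin
  ℕ→ℚ 2 * (ℕ→ℚ k + ℕ→ℚ i + 1ℚ) * A   ≡⟨ cong (_* A) cast ⟨
  ℕ→ℚ d * A                           ≡⟨ ℚ.*-comm (ℕ→ℚ d) A ⟩
  A * ℕ→ℚ d                           ≡⟨ p÷₀q*q≡p _ (ℕ→ℚ d) (ℕ→ℚ-≢0 d ℕ.z<s) ⟩
  (ℕ→ℚ 2 * ℕ→ℚ i + 1ℚ) * pochhammerRatio k i ∎
  where
  A = pochhammerRatio k (suc i)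
  d = 2 ℕ.* suc (k ℕ.+ i)
  cast : ℕ→ℚ d ≡ ℕ→ℚ 2 * (ℕ→ℚ k + ℕ→ℚ i + 1ℚ)
  cast = trans (ℕ→ℚ-homo-* 2 (suc (k ℕ.+ i)))
    (cong (ℕ→ℚ 2 *_) (trans (ℕ→ℚ-suc (k ℕ.+ i)) (cong (_+ 1ℚ) (ℕ→ℚ-homo-+ k i))))

summand : ℕ → ℕ → ℕ → ℚ
summand k r i = ℕ→ℚ (r C (2 ℕ.* i)) * pochhammerRatio k i

binomialSum : ℕ → ℕ → ℚ
binomialSum k r = sumRange (suc r) (summand k r)

summand-suc : ∀ k r i → summand k r (suc i) ≡ ℕ→ℚ (r C suc (suc (2 ℕ.* i))) * pochhammerRatio k (suc i)
summand-suc k r i = cong (λ n → ℕ→ℚ (r C n) * pochhammerRatio k (suc i)) (ℕ.*-suc 2 i)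

summand-vanishes : ∀ k r i → r ℕ.< 2 ℕ.* i → summand k r i ≡ 0ℚ
summand-vanishes k r i r<2i =
  trans (cong (λ n → ℕ→ℚ n * pochhammerRatio k i) (k>n⇒nCk≡0 r<2i)) (ℚ.*-zeroˡ (pochhammerRatio k i))

-- The coefficients of the first-order recurrence satisfied by both sides of the theorem.
α β : ℕ → ℕ → ℚ
α k r = ℕ→ℚ (suc (2 ℕ.* k ℕ.+ r))
β k r = ℕ→ℚ (suc (2 ℕ.* k ℕ.+ 2 ℕ.* r))

α≡2k+r+1 : ∀ k r → α k r ≡ ℕ→ℚ 2 * ℕ→ℚ k + ℕ→ℚ r + 1ℚ
α≡2k+r+1 k r = trans (ℕ→ℚ-suc (2 ℕ.* k ℕ.+ r))
  (cong (_+ 1ℚ) (trans (ℕ→ℚ-homo-+ (2 ℕ.* k) r) (cong (_+ ℕ→ℚ r) (ℕ→ℚ-homo-* 2 k))))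

β≡2k+2r+1 : ∀ k r → β k r ≡ ℕ→ℚ 2 * ℕ→ℚ k + ℕ→ℚ 2 * ℕ→ℚ r + 1ℚ
β≡2k+2r+1 k r = trans (ℕ→ℚ-suc (2 ℕ.* k ℕ.+ 2 ℕ.* r))
  (cong (_+ 1ℚ) (trans (ℕ→ℚ-homo-+ (2 ℕ.* k) (2 ℕ.* r)) (cong₂ _+_ (ℕ→ℚ-homo-* 2 k) (ℕ→ℚ-homo-* 2 r))))

certificate : ℕ → ℕ → ℕ → ℚ
certificate k r zero    = 0ℚ
certificate k r (suc i) = - (ℕ→ℚ (r C suc (2 ℕ.* i)) * (ℕ→ℚ 2 * ℕ→ℚ i + 1ℚ) * pochhammerRatio k i)

certificate-vanishes : ∀ k r i → r ℕ.< suc (2 ℕ.* i) → certificate k r (suc i) ≡ 0ℚ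
certificate-vanishes k r i r<2i+1 =
  trans (cong (λ n → - (ℕ→ℚ n * (ℕ→ℚ 2 * ℕ→ℚ i + 1ℚ) * pochhammerRatio k i)) (k>n⇒nCk≡0 r<2i+1))
        (zero-product (ℕ→ℚ 2 * ℕ→ℚ i + 1ℚ) (pochhammerRatio k i))
  where
  zero-product : ∀ c a → - (0ℚ * c * a) ≡ 0ℚ
  zero-product = solve-∀ ℚ-ring

certificate-identity : ∀ K R J x y z A B →
  (ℕ→ℚ 2 * J + 1ℚ + 1ℚ) * y ≡ (R - (ℕ→ℚ 2 * J + 1ℚ)) * x →
  (ℕ→ℚ 2 + ℕ→ℚ 2 * J + 1ℚ) * z ≡ (R - (ℕ→ℚ 2 + ℕ→ℚ 2 * J)) * y →
  ℕ→ℚ 2 * (K + J + 1ℚ) * A ≡ (ℕ→ℚ 2 * J + 1ℚ) * B →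
  (ℕ→ℚ 2 * K + R + 1ℚ) * ((x + y) * A) - (ℕ→ℚ 2 * K + ℕ→ℚ 2 * R + 1ℚ) * (y * A)
    ≡ - (z * (ℕ→ℚ 2 * (J + 1ℚ) + 1ℚ) * A) - - (x * (ℕ→ℚ 2 * J + 1ℚ) * B)
certificate-identity K R J x y z A B y-step z-step A-step = begin
  (ℕ→ℚ 2 * K + R + 1ℚ) * ((x + y) * A) - (ℕ→ℚ 2 * K + ℕ→ℚ 2 * R + 1ℚ) * (y * A)
    ≡⟨ solve (K ∷ R ∷ J ∷ x ∷ y ∷ A ∷ []) ℚ-ring ⟩
  x * (ℕ→ℚ 2 * (K + J + 1ℚ) * A) - (R - (ℕ→ℚ 2 + ℕ→ℚ 2 * J)) * y * A
    + ((R - (ℕ→ℚ 2 * J + 1ℚ)) * x - (ℕ→ℚ 2 * J + 1ℚ + 1ℚ) * y) * A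
    ≡⟨ cong₂ (λ u v → x * u - v * A + (w - (ℕ→ℚ 2 * J + 1ℚ + 1ℚ) * y) * A) A-step (sym z-step) ⟩
  x * ((ℕ→ℚ 2 * J + 1ℚ) * B) - (ℕ→ℚ 2 + ℕ→ℚ 2 * J + 1ℚ) * z * A
    + (w - (ℕ→ℚ 2 * J + 1ℚ + 1ℚ) * y) * A
    ≡⟨ cong (λ v → x * ((ℕ→ℚ 2 * J + 1ℚ) * B) - (ℕ→ℚ 2 + ℕ→ℚ 2 * J + 1ℚ) * z * A
                   + (v - (ℕ→ℚ 2 * J + 1ℚ + 1ℚ) * y) * A) (sym y-step) ⟩
  x * ((ℕ→ℚ 2 * J + 1ℚ) * B) - (ℕ→ℚ 2 + ℕ→ℚ 2 * J + 1ℚ) * z * A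
    + ((ℕ→ℚ 2 * J + 1ℚ + 1ℚ) * y - (ℕ→ℚ 2 * J + 1ℚ + 1ℚ) * y) * A
    ≡⟨ solve (J ∷ x ∷ y ∷ z ∷ A ∷ B ∷ []) ℚ-ring ⟩
  - (z * (ℕ→ℚ 2 * (J + 1ℚ) + 1ℚ) * A) - - (x * (ℕ→ℚ 2 * J + 1ℚ) * B) ∎
  where w = (R - (ℕ→ℚ 2 * J + 1ℚ)) * x

summand-telescopes : ∀ k r i →
  α k r * summand k (suc r) i - β k r * summand k r i ≡ certificate k r (suc i) - certificate k r i
summand-telescopes k r zero = begin
  α k r * (1ℚ * 1ℚ) - β k r * (1ℚ * 1ℚ)
    ≡⟨ cong₂ (λ a b → a * (1ℚ * 1ℚ) - b * (1ℚ * 1ℚ)) (α≡2k+r+1 k r) (β≡2k+2r+1 k r) ⟩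
  (ℕ→ℚ 2 * ℕ→ℚ k + ℕ→ℚ r + 1ℚ) * (1ℚ * 1ℚ) - (ℕ→ℚ 2 * ℕ→ℚ k + ℕ→ℚ 2 * ℕ→ℚ r + 1ℚ) * (1ℚ * 1ℚ)
    ≡⟨ difference (ℕ→ℚ k) (ℕ→ℚ r) ⟩
  - (ℕ→ℚ r * (ℕ→ℚ 2 * ℕ→ℚ 0 + 1ℚ) * 1ℚ) - 0ℚ
    ≡⟨ cong (λ n → - (ℕ→ℚ n * (ℕ→ℚ 2 * ℕ→ℚ 0 + 1ℚ) * 1ℚ) - 0ℚ) (nC1≡n r) ⟨
  certificate k r 1 - certificate k r 0 ∎
  where
  difference : ∀ K R → (ℕ→ℚ 2 * K + R + 1ℚ) * (1ℚ * 1ℚ) - (ℕ→ℚ 2 * K + ℕ→ℚ 2 * R + 1ℚ) * (1ℚ * 1ℚ)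
                       ≡ - (R * (ℕ→ℚ 2 * ℕ→ℚ 0 + 1ℚ) * 1ℚ) - 0ℚ
  difference = solve-∀ ℚ-ring
summand-telescopes k r (suc j) = begin
  α k r * summand k (suc r) (suc j) - β k r * summand k r (suc j)
    ≡⟨ cong₂ (λ a b → α k r * a - β k r * b) (summand-suc k (suc r) j) (summand-suc k r j) ⟩
  α k r * (ℕ→ℚ (suc r C suc (suc (2 ℕ.* j))) * A) - β k r * (y * A)
    ≡⟨ cong₂ (λ a b → a - b * (y * A))
             (cong₂ (λ a c → a * (c * A)) (α≡2k+r+1 k r) pascal) (β≡2k+2r+1 k r) ⟩
  (ℕ→ℚ 2 * K + R + 1ℚ) * ((x + y) * A) - (ℕ→ℚ 2 * K + ℕ→ℚ 2 * R + 1ℚ) * (y * A)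
    ≡⟨ certificate-identity K R J x y z A B y-step z-step (pochhammerRatio-suc k j) ⟩
  - (z * (ℕ→ℚ 2 * (J + 1ℚ) + 1ℚ) * A) - - (x * (ℕ→ℚ 2 * J + 1ℚ) * B)
    ≡⟨ cong₂ (λ n c → - (ℕ→ℚ (r C suc n) * (ℕ→ℚ 2 * c + 1ℚ) * A) - - (x * (ℕ→ℚ 2 * J + 1ℚ) * B))
             (ℕ.*-suc 2 j) (ℕ→ℚ-suc j) ⟨
  certificate k r (suc (suc j)) - certificate k r (suc j) ∎
  where
  K = ℕ→ℚ k; R = ℕ→ℚ r; J = ℕ→ℚ j
  A = pochhammerRatio k (suc j); B = pochhammerRatio k j
  x = ℕ→ℚ (r C suc (2 ℕ.* j))
  y = ℕ→ℚ (r C suc (suc (2 ℕ.* j)))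
  z = ℕ→ℚ (r C suc (suc (suc (2 ℕ.* j))))
  pascal : ℕ→ℚ (suc r C suc (suc (2 ℕ.* j))) ≡ x + y
  pascal = trans (cong ℕ→ℚ (sym (nCk+nC[k+1]≡[n+1]C[k+1] r (suc (2 ℕ.* j)))))
                 (ℕ→ℚ-homo-+ (r C suc (2 ℕ.* j)) (r C suc (suc (2 ℕ.* j))))
  y-step : (ℕ→ℚ 2 * J + 1ℚ + 1ℚ) * y ≡ (R - (ℕ→ℚ 2 * J + 1ℚ)) * x
  y-step = [k+1]*nC[k+1]≡[n-k]*nCk r (suc (2 ℕ.* j))
             (trans (ℕ→ℚ-suc (2 ℕ.* j)) (cong (_+ 1ℚ) (ℕ→ℚ-homo-* 2 j)))
  z-step : (ℕ→ℚ 2 + ℕ→ℚ 2 * J + 1ℚ) * z ≡ (R - (ℕ→ℚ 2 + ℕ→ℚ 2 * J)) * y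
  z-step = [k+1]*nC[k+1]≡[n-k]*nCk r (suc (suc (2 ℕ.* j)))
             (trans (ℕ→ℚ-homo-+ 2 (2 ℕ.* j)) (cong (ℕ→ℚ 2 +_) (ℕ→ℚ-homo-* 2 j)))

binomialSum-rec : ∀ k r → α k r * binomialSum k (suc r) ≡ β k r * binomialSum k r
binomialSum-rec k r = begin
  α k r * S′                                ≡⟨ add-sub (α k r * S′) (β k r * T) ⟩
  (α k r * S′ - β k r * T) + β k r * T      ≡⟨ cong₂ (λ d t → d + β k r * t) telescoped T≡S ⟩
  0ℚ + β k r * S                            ≡⟨ ℚ.+-identityˡ (β k r * S) ⟩
  β k r * S                                 ∎
  where
  S = binomialSum k r; S′ = binomialSum k (suc r)
  T = sumRange (suc (suc r)) (summand k r)
  r<2[r+1] : r ℕ.< 2 ℕ.* suc r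
  r<2[r+1] = ℕ.m≤m+n (suc r) (1 ℕ.* suc r)
  T≡S : T ≡ S
  T≡S = trans (cong (S +_) (summand-vanishes k r (suc r) r<2[r+1])) (ℚ.+-identityʳ S)
  telescoped : α k r * S′ - β k r * T ≡ 0ℚ
  telescoped = begin
    α k r * S′ - β k r * T
      ≡⟨ sumRange-linear (suc (suc r)) (α k r) (β k r) (summand k (suc r)) (summand k r) ⟨
    sumRange (suc (suc r)) (λ i → α k r * summand k (suc r) i - β k r * summand k r i)
      ≡⟨ sumRange-telescope _ (certificate k r) (summand-telescopes k r) (suc (suc r)) ⟩
    certificate k r (suc (suc r)) - 0ℚ
      ≡⟨ cong (_- 0ℚ) (certificate-vanishes k r (suc r) (ℕ.m<n⇒m<1+n r<2[r+1])) ⟩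
    0ℚ - 0ℚ ∎
  add-sub : ∀ a b → a ≡ (a - b) + b
  add-sub = solve-∀ ℚ-ring

closedForm : ℕ → ℕ → ℚ
closedForm k r = ((ℕ→ℚ 1 ÷₀ ℕ→ℚ 2) ^ℚ r) * (ℕ→ℚ ((2 ℕ.* k ℕ.+ 2 ℕ.* r) C r) ÷₀ ℕ→ℚ ((k ℕ.+ r) C r))

closedForm-rec-identity : ∀ a b h H x y x′ y′ u v → u * y′ ≡ x′ → v * y ≡ x → h * ℕ→ℚ 2 ≡ 1ℚ →
  a * x′ * y ≡ ℕ→ℚ 2 * b * x * y′ → a * (h * H * u) * (y * y′) ≡ b * (H * v) * (y * y′)
closedForm-rec-identity a b h H x y x′ y′ u v uy′≡x′ vy≡x 2h≡1 a-rec = begin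
  a * (h * H * u) * (y * y′)        ≡⟨ solve (a ∷ h ∷ H ∷ u ∷ y ∷ y′ ∷ []) ℚ-ring ⟩
  h * H * (a * (u * y′) * y)        ≡⟨ cong (λ t → h * H * (a * t * y)) uy′≡x′ ⟩
  h * H * (a * x′ * y)              ≡⟨ cong (h * H *_) a-rec ⟩
  h * H * (ℕ→ℚ 2 * b * x * y′)      ≡⟨ solve (b ∷ h ∷ H ∷ x ∷ y′ ∷ []) ℚ-ring ⟩
  h * ℕ→ℚ 2 * (H * b * x * y′)      ≡⟨ cong₂ (λ c t → c * (H * b * t * y′)) 2h≡1 (sym vy≡x) ⟩
  1ℚ * (H * b * (v * y) * y′)       ≡⟨ solve (b ∷ H ∷ v ∷ y ∷ y′ ∷ []) ℚ-ring ⟩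
  b * (H * v) * (y * y′)            ∎

closedForm-rec : ∀ k r → α k r * closedForm k (suc r) ≡ β k r * closedForm k r
closedForm-rec k r = *-cancelʳ-≡ _ _ (y * y′) (*-≢0 y≢0 y′≢0)
  (closedForm-rec-identity (α k r) (β k r) h (h ^ℚ r) x y x′ y′ (x′ ÷₀ y′) (x ÷₀ y)
    (p÷₀q*q≡p x′ y′ y′≢0) (p÷₀q*q≡p x y y≢0) (p÷₀q*q≡p (ℕ→ℚ 1) (ℕ→ℚ 2) (ℕ→ℚ-≢0 2 ℕ.z<s)) cast)
  where
  h = ℕ→ℚ 1 ÷₀ ℕ→ℚ 2
  X = (2 ℕ.* k ℕ.+ 2 ℕ.* r) C r; X′ = (2 ℕ.* k ℕ.+ 2 ℕ.* suc r) C suc r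
  Y = (k ℕ.+ r) C r;            Y′ = (k ℕ.+ suc r) C suc r
  x = ℕ→ℚ X; x′ = ℕ→ℚ X′; y = ℕ→ℚ Y; y′ = ℕ→ℚ Y′
  y≢0 = ℕ→ℚ-≢0 Y ([n+k]Ck>0 k r)
  y′≢0 = ℕ→ℚ-≢0 Y′ ([n+k]Ck>0 k (suc r))
  ℕ→ℚ-homo-*³ : ∀ a b c → ℕ→ℚ (a ℕ.* b ℕ.* c) ≡ ℕ→ℚ a * ℕ→ℚ b * ℕ→ℚ c
  ℕ→ℚ-homo-*³ a b c = trans (ℕ→ℚ-homo-* (a ℕ.* b) c) (cong (_* ℕ→ℚ c) (ℕ→ℚ-homo-* a b))
  cast : α k r * x′ * y ≡ ℕ→ℚ 2 * β k r * x * y′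
  cast = begin
    α k r * x′ * y                                     ≡⟨ ℕ→ℚ-homo-*³ (suc (2 ℕ.* k ℕ.+ r)) X′ Y ⟨
    ℕ→ℚ (suc (2 ℕ.* k ℕ.+ r) ℕ.* X′ ℕ.* Y)            ≡⟨ cong ℕ→ℚ (binomialQuotient-rec k r) ⟩
    ℕ→ℚ (2 ℕ.* suc (2 ℕ.* k ℕ.+ 2 ℕ.* r) ℕ.* X ℕ.* Y′)
      ≡⟨ ℕ→ℚ-homo-*³ (2 ℕ.* suc (2 ℕ.* k ℕ.+ 2 ℕ.* r)) X Y′ ⟩
    ℕ→ℚ (2 ℕ.* suc (2 ℕ.* k ℕ.+ 2 ℕ.* r)) * x * y′
      ≡⟨ cong (λ c → c * x * y′) (ℕ→ℚ-homo-* 2 (suc (2 ℕ.* k ℕ.+ 2 ℕ.* r))) ⟩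
    ℕ→ℚ 2 * β k r * x * y′                             ∎

recurrence-unique : ∀ (a b u v : ℕ → ℚ) → (∀ r → a r ≢ 0ℚ) →
  (∀ r → a r * u (suc r) ≡ b r * u r) → (∀ r → a r * v (suc r) ≡ b r * v r) →
  u 0 ≡ v 0 → ∀ r → u r ≡ v r
recurrence-unique a b u v a≢0 u-rec v-rec u0≡v0 zero    = u0≡v0
recurrence-unique a b u v a≢0 u-rec v-rec u0≡v0 (suc r) = *-cancelʳ-≡ _ _ (a r) (a≢0 r) (begin
  u (suc r) * a r    ≡⟨ ℚ.*-comm (u (suc r)) (a r) ⟩
  a r * u (suc r)    ≡⟨ u-rec r ⟩
  b r * u r          ≡⟨ cong (b r *_) (recurrence-unique a b u v a≢0 u-rec v-rec u0≡v0 r) ⟩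
  b r * v r          ≡⟨ v-rec r ⟨
  a r * v (suc r)    ≡⟨ ℚ.*-comm (a r) (v (suc r)) ⟩
  v (suc r) * a r    ∎)

binomialSum≡closedForm : ∀ k r → binomialSum k r ≡ closedForm k r
binomialSum≡closedForm k = recurrence-unique (α k) (β k) (binomialSum k) (closedForm k)
  (λ r → ℕ→ℚ-≢0 (suc (2 ℕ.* k ℕ.+ r)) ℕ.z<s) (binomialSum-rec k) (closedForm-rec k) refl

numerator : ℚ → ℚ → ℚ
numerator R L = (R - ℕ→ℚ 2 * L) * (R - ℕ→ℚ 2 * L) * (R - ℕ→ℚ 2 * L - 1ℚ) * (R - ℕ→ℚ 2 * L - 1ℚ)

denominator : ℚ → ℚ → ℚ → ℚ → ℚ
denominator R K I L = (ℕ→ℚ 2 * I - ℕ→ℚ 2 * L) * (ℕ→ℚ 2 * I + ℕ→ℚ 2 * K - ℕ→ℚ 2 * L)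
  * (R - ℕ→ℚ 2 * I + ℕ→ℚ 2 * L + 1ℚ) * (R - ℕ→ℚ 2 * I + ℕ→ℚ 2 * L + ℕ→ℚ 2)

term : ℕ → ℕ → ℕ → ℚ
term k r i = prodRange i (λ l → numerator (ℕ→ℚ r) (ℕ→ℚ l) ÷₀ denominator (ℕ→ℚ r) (ℕ→ℚ k) (ℕ→ℚ i) (ℕ→ℚ l))

numerators : ℕ → ℕ → ℚ
numerators r i = prodRange i (λ l → numerator (ℕ→ℚ r) (ℕ→ℚ l))

denominators : ℕ → ℕ → ℕ → ℚ
denominators k r i = prodRange i (λ l → denominator (ℕ→ℚ r) (ℕ→ℚ k) (ℕ→ℚ i) (ℕ→ℚ l))

denominator-shift : ∀ R K I L → denominator R K (I + 1ℚ) (L + 1ℚ) ≡ denominator R K I L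
denominator-shift R K I L = begin
  (ℕ→ℚ 2 * (I + 1ℚ) - ℕ→ℚ 2 * (L + 1ℚ)) * (ℕ→ℚ 2 * (I + 1ℚ) + ℕ→ℚ 2 * K - ℕ→ℚ 2 * (L + 1ℚ))
    * (R - ℕ→ℚ 2 * (I + 1ℚ) + ℕ→ℚ 2 * (L + 1ℚ) + 1ℚ)
    * (R - ℕ→ℚ 2 * (I + 1ℚ) + ℕ→ℚ 2 * (L + 1ℚ) + ℕ→ℚ 2)
    ≡⟨ solve (R ∷ K ∷ I ∷ L ∷ []) ℚ-ring ⟩
  (ℕ→ℚ 2 * I - ℕ→ℚ 2 * L) * (ℕ→ℚ 2 * I + ℕ→ℚ 2 * K - ℕ→ℚ 2 * L)
    * (R - ℕ→ℚ 2 * I + ℕ→ℚ 2 * L + 1ℚ) * (R - ℕ→ℚ 2 * I + ℕ→ℚ 2 * L + ℕ→ℚ 2) ∎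

denominator-factorise : ∀ R K I L D E → I ≡ L + D + 1ℚ → R ≡ ℕ→ℚ 2 * I + E →
  denominator R K I L
    ≡ ℕ→ℚ 2 * (D + 1ℚ) * (ℕ→ℚ 2 * (D + K + 1ℚ)) * (E + ℕ→ℚ 2 * L + 1ℚ) * (E + ℕ→ℚ 2 * L + 1ℚ + 1ℚ)
denominator-factorise R K I L D E refl refl = begin
  (ℕ→ℚ 2 * I - ℕ→ℚ 2 * L) * (ℕ→ℚ 2 * I + ℕ→ℚ 2 * K - ℕ→ℚ 2 * L)
    * (ℕ→ℚ 2 * I + E - ℕ→ℚ 2 * I + ℕ→ℚ 2 * L + 1ℚ) * (ℕ→ℚ 2 * I + E - ℕ→ℚ 2 * I + ℕ→ℚ 2 * L + ℕ→ℚ 2)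
    ≡⟨ solve (K ∷ L ∷ D ∷ E ∷ []) ℚ-ring ⟩
  ℕ→ℚ 2 * (D + 1ℚ) * (ℕ→ℚ 2 * (D + K + 1ℚ)) * (E + ℕ→ℚ 2 * L + 1ℚ) * (E + ℕ→ℚ 2 * L + 1ℚ + 1ℚ) ∎

denominator≢0 : ∀ k r i l → l ℕ.< i → 2 ℕ.* i ℕ.≤ r →
  denominator (ℕ→ℚ r) (ℕ→ℚ k) (ℕ→ℚ i) (ℕ→ℚ l) ≢ 0ℚ
denominator≢0 k r i l l<i 2i≤r = subst (_≢ 0ℚ) (sym factorised)
  (*-≢0 (*-≢0 (*-≢0 (ℕ→ℚ-≢0 (2 ℕ.* suc d) ℕ.z<s) (ℕ→ℚ-≢0 (2 ℕ.* suc (d ℕ.+ k)) ℕ.z<s))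
                (ℕ→ℚ-≢0 (suc (e ℕ.+ 2 ℕ.* l)) ℕ.z<s)) (ℕ→ℚ-≢0 (suc (suc (e ℕ.+ 2 ℕ.* l))) ℕ.z<s))
  where
  d = i ℕ.∸ suc l; e = r ℕ.∸ 2 ℕ.* i
  D = ℕ→ℚ d; E = ℕ→ℚ e; K = ℕ→ℚ k; L = ℕ→ℚ l
  I≡ : ℕ→ℚ i ≡ L + D + 1ℚ
  I≡ = begin
    ℕ→ℚ i                  ≡⟨ cong ℕ→ℚ (ℕ.m+[n∸m]≡n l<i) ⟨
    ℕ→ℚ (suc (l ℕ.+ d))    ≡⟨ ℕ→ℚ-suc (l ℕ.+ d) ⟩
    ℕ→ℚ (l ℕ.+ d) + 1ℚ     ≡⟨ cong (_+ 1ℚ) (ℕ→ℚ-homo-+ l d) ⟩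
    L + D + 1ℚ             ∎
  R≡ : ℕ→ℚ r ≡ ℕ→ℚ 2 * ℕ→ℚ i + E
  R≡ = begin
    ℕ→ℚ r                      ≡⟨ cong ℕ→ℚ (ℕ.m+[n∸m]≡n 2i≤r) ⟨
    ℕ→ℚ (2 ℕ.* i ℕ.+ e)        ≡⟨ ℕ→ℚ-homo-+ (2 ℕ.* i) e ⟩
    ℕ→ℚ (2 ℕ.* i) + E          ≡⟨ cong (_+ E) (ℕ→ℚ-homo-* 2 i) ⟩
    ℕ→ℚ 2 * ℕ→ℚ i + E          ∎
  2[x+1]≡ : ∀ x → ℕ→ℚ (2 ℕ.* suc x) ≡ ℕ→ℚ 2 * (ℕ→ℚ x + 1ℚ)
  2[x+1]≡ x = trans (ℕ→ℚ-homo-* 2 (suc x)) (cong (ℕ→ℚ 2 *_) (ℕ→ℚ-suc x))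
  E+2L≡ : ℕ→ℚ (e ℕ.+ 2 ℕ.* l) ≡ E + ℕ→ℚ 2 * L
  E+2L≡ = trans (ℕ→ℚ-homo-+ e (2 ℕ.* l)) (cong (E +_) (ℕ→ℚ-homo-* 2 l))
  factorised : denominator (ℕ→ℚ r) K (ℕ→ℚ i) L
    ≡ ℕ→ℚ (2 ℕ.* suc d) * ℕ→ℚ (2 ℕ.* suc (d ℕ.+ k)) * ℕ→ℚ (suc (e ℕ.+ 2 ℕ.* l)) * ℕ→ℚ (suc (suc (e ℕ.+ 2 ℕ.* l)))
  factorised = begin
    denominator (ℕ→ℚ r) K (ℕ→ℚ i) L
      ≡⟨ denominator-factorise (ℕ→ℚ r) K (ℕ→ℚ i) L D E I≡ R≡ ⟩
    ℕ→ℚ 2 * (D + 1ℚ) * (ℕ→ℚ 2 * (D + K + 1ℚ)) * (E + ℕ→ℚ 2 * L + 1ℚ) * (E + ℕ→ℚ 2 * L + 1ℚ + 1ℚ)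
      ≡⟨ cong₂ (λ a b → a * b * (E + ℕ→ℚ 2 * L + 1ℚ) * (E + ℕ→ℚ 2 * L + 1ℚ + 1ℚ))
               (2[x+1]≡ d) (trans (2[x+1]≡ (d ℕ.+ k)) (cong (λ x → ℕ→ℚ 2 * (x + 1ℚ)) (ℕ→ℚ-homo-+ d k))) ⟨
    ℕ→ℚ (2 ℕ.* suc d) * ℕ→ℚ (2 ℕ.* suc (d ℕ.+ k)) * (E + ℕ→ℚ 2 * L + 1ℚ) * (E + ℕ→ℚ 2 * L + 1ℚ + 1ℚ)
      ≡⟨ cong₂ (λ a b → ℕ→ℚ (2 ℕ.* suc d) * ℕ→ℚ (2 ℕ.* suc (d ℕ.+ k)) * a * b)
               (trans (ℕ→ℚ-suc (e ℕ.+ 2 ℕ.* l)) (cong (_+ 1ℚ) E+2L≡))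
               (trans (ℕ→ℚ-suc (suc (e ℕ.+ 2 ℕ.* l)))
                      (cong (_+ 1ℚ) (trans (ℕ→ℚ-suc (e ℕ.+ 2 ℕ.* l)) (cong (_+ 1ℚ) E+2L≡)))) ⟨
    ℕ→ℚ (2 ℕ.* suc d) * ℕ→ℚ (2 ℕ.* suc (d ℕ.+ k)) * ℕ→ℚ (suc (e ℕ.+ 2 ℕ.* l)) * ℕ→ℚ (suc (suc (e ℕ.+ 2 ℕ.* l))) ∎

summand-step-identity : ∀ R K I x w y A B →
  (ℕ→ℚ 2 * I + 1ℚ) * w ≡ (R - ℕ→ℚ 2 * I) * x →
  (ℕ→ℚ 2 * I + 1ℚ + 1ℚ) * y ≡ (R - (ℕ→ℚ 2 * I + 1ℚ)) * w →
  ℕ→ℚ 2 * (K + I + 1ℚ) * A ≡ (ℕ→ℚ 2 * I + 1ℚ) * B →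
  y * A * denominator R K (I + 1ℚ) 0ℚ ≡ x * B * numerator R I
summand-step-identity R K I x w y A B w-step y-step A-step = begin
  y * A * ((ℕ→ℚ 2 * (I + 1ℚ) - ℕ→ℚ 2 * 0ℚ) * (ℕ→ℚ 2 * (I + 1ℚ) + ℕ→ℚ 2 * K - ℕ→ℚ 2 * 0ℚ)
           * (R - ℕ→ℚ 2 * (I + 1ℚ) + ℕ→ℚ 2 * 0ℚ + 1ℚ) * (R - ℕ→ℚ 2 * (I + 1ℚ) + ℕ→ℚ 2 * 0ℚ + ℕ→ℚ 2))
    ≡⟨ solve (R ∷ K ∷ I ∷ y ∷ A ∷ []) ℚ-ring ⟩
  (ℕ→ℚ 2 * I + 1ℚ + 1ℚ) * y * (ℕ→ℚ 2 * (K + I + 1ℚ) * A) * (R - (ℕ→ℚ 2 * I + 1ℚ)) * (R - ℕ→ℚ 2 * I)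
    ≡⟨ cong₂ (λ u v → u * v * (R - (ℕ→ℚ 2 * I + 1ℚ)) * (R - ℕ→ℚ 2 * I)) y-step A-step ⟩
  (R - (ℕ→ℚ 2 * I + 1ℚ)) * w * ((ℕ→ℚ 2 * I + 1ℚ) * B) * (R - (ℕ→ℚ 2 * I + 1ℚ)) * (R - ℕ→ℚ 2 * I)
    ≡⟨ solve (R ∷ I ∷ w ∷ B ∷ []) ℚ-ring ⟩
  (ℕ→ℚ 2 * I + 1ℚ) * w * (B * (R - (ℕ→ℚ 2 * I + 1ℚ)) * (R - (ℕ→ℚ 2 * I + 1ℚ)) * (R - ℕ→ℚ 2 * I))
    ≡⟨ cong (_* (B * (R - (ℕ→ℚ 2 * I + 1ℚ)) * (R - (ℕ→ℚ 2 * I + 1ℚ)) * (R - ℕ→ℚ 2 * I))) w-step ⟩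
  (R - ℕ→ℚ 2 * I) * x * (B * (R - (ℕ→ℚ 2 * I + 1ℚ)) * (R - (ℕ→ℚ 2 * I + 1ℚ)) * (R - ℕ→ℚ 2 * I))
    ≡⟨ solve (R ∷ I ∷ x ∷ B ∷ []) ℚ-ring ⟩
  x * B * ((R - ℕ→ℚ 2 * I) * (R - ℕ→ℚ 2 * I) * (R - ℕ→ℚ 2 * I - 1ℚ) * (R - ℕ→ℚ 2 * I - 1ℚ)) ∎

summand-step : ∀ k r i →
  summand k r (suc i) * denominator (ℕ→ℚ r) (ℕ→ℚ k) (ℕ→ℚ (suc i)) (ℕ→ℚ 0)
    ≡ summand k r i * numerator (ℕ→ℚ r) (ℕ→ℚ i)
summand-step k r i = begin
  summand k r (suc i) * denominator (ℕ→ℚ r) (ℕ→ℚ k) (ℕ→ℚ (suc i)) (ℕ→ℚ 0)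
    ≡⟨ cong₂ (λ s c → s * denominator (ℕ→ℚ r) (ℕ→ℚ k) c 0ℚ) (summand-suc k r i) (ℕ→ℚ-suc i) ⟩
  y * A * denominator (ℕ→ℚ r) (ℕ→ℚ k) (ℕ→ℚ i + 1ℚ) 0ℚ
    ≡⟨ summand-step-identity (ℕ→ℚ r) (ℕ→ℚ k) (ℕ→ℚ i) x w y A B w-step y-step (pochhammerRatio-suc k i) ⟩
  x * B * numerator (ℕ→ℚ r) (ℕ→ℚ i) ∎
  where
  A = pochhammerRatio k (suc i); B = pochhammerRatio k i
  x = ℕ→ℚ (r C (2 ℕ.* i)); w = ℕ→ℚ (r C suc (2 ℕ.* i)); y = ℕ→ℚ (r C suc (suc (2 ℕ.* i)))
  w-step : (ℕ→ℚ 2 * ℕ→ℚ i + 1ℚ) * w ≡ (ℕ→ℚ r - ℕ→ℚ 2 * ℕ→ℚ i) * x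
  w-step = [k+1]*nC[k+1]≡[n-k]*nCk r (2 ℕ.* i) (ℕ→ℚ-homo-* 2 i)
  y-step : (ℕ→ℚ 2 * ℕ→ℚ i + 1ℚ + 1ℚ) * y ≡ (ℕ→ℚ r - (ℕ→ℚ 2 * ℕ→ℚ i + 1ℚ)) * w
  y-step = [k+1]*nC[k+1]≡[n-k]*nCk r (suc (2 ℕ.* i))
             (trans (ℕ→ℚ-suc (2 ℕ.* i)) (cong (_+ 1ℚ) (ℕ→ℚ-homo-* 2 i)))

denominators-suc : ∀ k r i →
  denominators k r (suc i) ≡ denominator (ℕ→ℚ r) (ℕ→ℚ k) (ℕ→ℚ (suc i)) (ℕ→ℚ 0) * denominators k r i
denominators-suc k r i = trans (prodRange-head i (λ l → D (ℕ→ℚ (suc i)) (ℕ→ℚ l)))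
  (cong (D (ℕ→ℚ (suc i)) (ℕ→ℚ 0) *_) (prodRange-cong i (λ l _ → shift l)))
  where
  D = denominator (ℕ→ℚ r) (ℕ→ℚ k)
  shift : ∀ l → D (ℕ→ℚ (suc i)) (ℕ→ℚ (suc l)) ≡ D (ℕ→ℚ i) (ℕ→ℚ l)
  shift l = trans (cong₂ D (ℕ→ℚ-suc i) (ℕ→ℚ-suc l)) (denominator-shift (ℕ→ℚ r) (ℕ→ℚ k) (ℕ→ℚ i) (ℕ→ℚ l))

summand*denominators≡numerators : ∀ k r i → summand k r i * denominators k r i ≡ numerators r i
summand*denominators≡numerators k r zero    = refl
summand*denominators≡numerators k r (suc i) = begin
  summand k r (suc i) * denominators k r (suc i)  ≡⟨ cong (summand k r (suc i) *_) (denominators-suc k r i) ⟩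
  summand k r (suc i) * (D₀ * denominators k r i)  ≡⟨ ℚ.*-assoc (summand k r (suc i)) D₀ _ ⟨
  summand k r (suc i) * D₀ * denominators k r i    ≡⟨ cong (_* denominators k r i) (summand-step k r i) ⟩
  summand k r i * N * denominators k r i           ≡⟨ swap (summand k r i) N (denominators k r i) ⟩
  summand k r i * denominators k r i * N
    ≡⟨ cong (_* N) (summand*denominators≡numerators k r i) ⟩
  numerators r i * N                               ∎
  where
  D₀ = denominator (ℕ→ℚ r) (ℕ→ℚ k) (ℕ→ℚ (suc i)) (ℕ→ℚ 0)
  N = numerator (ℕ→ℚ r) (ℕ→ℚ i)
  swap : ∀ a b c → a * b * c ≡ a * c * b
  swap = solve-∀ ℚ-ring

term≡summand : ∀ k r i → 2 ℕ.* i ℕ.≤ r → term k r i ≡ summand k r i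
term≡summand k r i 2i≤r = *-cancelʳ-≡ _ _ (denominators k r i) (prodRange-≢0 i D≢0) (begin
  term k r i * denominators k r i     ≡⟨ prodRange-÷₀ i _ _ D≢0 ⟩
  numerators r i                      ≡⟨ summand*denominators≡numerators k r i ⟨
  summand k r i * denominators k r i  ∎)
  where
  D≢0 : ∀ l → l ℕ.< i → denominator (ℕ→ℚ r) (ℕ→ℚ k) (ℕ→ℚ i) (ℕ→ℚ l) ≢ 0ℚ
  D≢0 l l<i = denominator≢0 k r i l l<i 2i≤r

lemmaA3 : (r κ′ : ℕ) → r ≥ 1 → κ′ ≥ 1 →
    sumRange (suc (r / 2)) (λ i →
      prodRange i (λ l →
        ((ℕ→ℚ r - ℕ→ℚ 2 * ℕ→ℚ l) * (ℕ→ℚ r - ℕ→ℚ 2 * ℕ→ℚ l)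
          * (ℕ→ℚ r - ℕ→ℚ 2 * ℕ→ℚ l - 1ℚ) * (ℕ→ℚ r - ℕ→ℚ 2 * ℕ→ℚ l - 1ℚ))
        ÷₀ ((ℕ→ℚ 2 * ℕ→ℚ i - ℕ→ℚ 2 * ℕ→ℚ l)
          * (ℕ→ℚ 2 * ℕ→ℚ i + ℕ→ℚ 2 * ℕ→ℚ κ′ - ℕ→ℚ 2 * ℕ→ℚ l)
          * (ℕ→ℚ r - ℕ→ℚ 2 * ℕ→ℚ i + ℕ→ℚ 2 * ℕ→ℚ l + 1ℚ)
          * (ℕ→ℚ r - ℕ→ℚ 2 * ℕ→ℚ i + ℕ→ℚ 2 * ℕ→ℚ l + ℕ→ℚ 2))))
    ≡ ((ℕ→ℚ 1 ÷₀ ℕ→ℚ 2) ^ℚ r)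
      * (ℕ→ℚ ((2 ℕ.* κ′ ℕ.+ 2 ℕ.* r) C r) ÷₀ ℕ→ℚ ((κ′ ℕ.+ r) C r))
lemmaA3 r κ′ _ _ = begin
  sumRange (suc (r / 2)) (term κ′ r)
    ≡⟨ sumRange-cong (suc (r / 2)) (λ i i<1+r/2 → term≡summand κ′ r i (2i≤r (ℕ.≤-pred i<1+r/2))) ⟩
  sumRange (suc (r / 2)) (summand κ′ r)
    ≡⟨ sumRange-extend (summand κ′ r) (ℕ.s≤s (m/n≤m r 2))
                       (λ i r/2<i → summand-vanishes κ′ r i (r<2i r/2<i)) ⟨
  binomialSum κ′ r
    ≡⟨ binomialSum≡closedForm κ′ r ⟩
  closedForm κ′ r ∎
  where
  2i≤r : ∀ {i} → i ℕ.≤ r / 2 → 2 ℕ.* i ℕ.≤ r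
  2i≤r {i} i≤r/2 = subst (ℕ._≤ r) (ℕ.*-comm i 2) (m≤o/n⇒m*n≤o r 2 i≤r/2)
  r<2i : ∀ {i} → r / 2 ℕ.< i → r ℕ.< 2 ℕ.* i
  r<2i {i} r/2<i = ℕ.≰⇒> (λ 2i≤r → ℕ.<⇒≱ r/2<i (m*n≤o⇒m≤o/n i 2 (subst (ℕ._≤ r) (ℕ.*-comm 2 i) 2i≤r)))
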